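{- Let $G$ be a $B_2$-EPG graph with a fixed $B_2$-EPG representation, let $a$ be a row, let $u,v$ be two vertices whose index contains $a$, and let $t$ be a proper typed interval on row $a$. If $u$ contains $t$ and $v$ intersects $t$, then $u$ and $v$ are adjacent in $G$.
   Context: An EPG representation of a graph $G$ assigns to every vertex $u$ a path $P_u$ in the rectangular grid, such that distinct $u,v$ are adjacent iff $P_u,P_v$ share a grid edge; a bend is a point where a path turns between horizontal and vertical; $G$ is $B_2$-EPG if some representation has every path with at most $2$ bends. Rows are horizontal grid lines, columns vertical ones; the point of row $a$ at column $\alpha$ is denoted $\alpha$. A vertex $u$ intersects a row if $P_u$ contains a grid edge of it; the index of $u$ is the set of rows it intersects. If $a$ is in the index of $u$, the extremities of $u$ on $a$ are the (exactly two) points of row $a$ at which $P_u$ stops or bends, and $P_u^a=[\alpha,\beta]$ is the segment of row $a$ between them (it contains at least one grid edge). Types: three symbols $\emptyset$ (empty), $\downarrow$, $\uparrow$. A typed interval on row $a$ is a pair of typed points written $[x\alpha,y\beta]$ where $\alpha\le\beta$ are points of row $a$ and $x,y$ are types. It is proper if $\alpha\neq\beta$, or $\alpha=\beta$ and $x=y\in\{\downarrow,\uparrow\}$. For typed intervals $t=[x\alpha,y\beta]$ and $t'=[x'\alpha',y'\beta']$ on row $a$ and an endpoint $z\gamma\in\{x'\alpha',y'\beta'\}$ of $t'$, $t$ is coherent with $z\gamma$ if (i) $\alpha<\gamma<\beta$, or (ii) $z=\emptyset$ and $[\alpha,\beta]$ contains the grid edge of $[\alpha',\beta']$ incident to $\gamma$,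 or (iii) $z\ne\emptyset$ and $z\gamma\in\{x\alpha,y\beta\}$. $t$ contains $t'$ if $[\alpha',\beta']\subseteq[\alpha,\beta]$ and $t$ is coherent with both endpoints of $t'$. $t$ intersects $t'$ if $[\alpha,\beta]\cap[\alpha',\beta']$ contains a grid edge, or $t$ is coherent with an endpoint of $t'$, or $t'$ is coherent with an endpoint of $t$. The t-projection of a vertex $u$ (with $a$ in its index) on $a$ is the typed interval $[x\alpha,y\beta]$ where $[\alpha,\beta]=P_u^a$ and the type of an extremity $\gamma\in\{\alpha,\beta\}$ is $\emptyset$ if $P_u$ stops at $\gamma$, $\downarrow$ if $P_u$ bends downwards at $\gamma$, and $\uparrow$ if it bends upwards at $\gamma$. A vertex $u$ contains (resp. intersects) a typed interval $t$ on row $a$ if $a$ is in the index of $u$ and the t-projection of $u$ on $a$ contains (resp. intersects) $t$. -}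

module Defs where

open import Data.Integer using (ℤ; _+_; _-_; _≤_; _<_; _⊓_; _⊔_; +_)
open import Data.Nat using (ℕ; suc)
import Data.Nat as ℕ
open import Data.List using (List; []; _∷_; length)
open import Data.List.Membership.Propositional using (_∈_)
open import Data.Maybe using (Maybe; just; nothing)
open import Data.Product using (_×_; _,_; proj₁; proj₂; ∃; ∃-syntax; Σ)
open import Data.Sum using (_⊎_)
open import Relation.Binary.PropositionalEquality using (_≡_; _≢_)

-- The grid.  A point is (x , y) : ℤ × ℤ; the row a is the horizontal line
-- y = a, and "the point α of row a" is (α , a).  "Up" = increasing y.

Point : Set
Point = ℤ × ℤ

-- Grid edges: hE x y joins (x,y)-(x+1,y); vE x y joins (x,y)-(x,y+1).
data GridEdge : Set where
  hE : ℤ → ℤ → GridEdge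
  vE : ℤ → ℤ → GridEdge

data Orient : Set where
  hor ver : Orient

data Step : Point → Point → Orient → Set where
  hstep : ∀ {x x' y} → x ≢ x' → Step (x , y) (x' , y) hor
  vstep : ∀ {x y y'} → y ≢ y' → Step (x , y) (x , y') ver

-- A list of corner points p₀ … p_k describes the grid path made of the
-- straight segments p₀p₁, p₁p₂, …, where consecutive segments are
-- perpendicular (so p₁ … p_{k-1} are exactly the bends).
data Chain : Maybe Orient → List Point → Set where
  done : ∀ {o p} → Chain o (p ∷ [])
  step : ∀ {o p q rest o'} → Step p q o' → o ≢ just o' →
         Chain (just o') (q ∷ rest) → Chain o (p ∷ q ∷ rest)

-- A grid path with at least one edge and at most 2 bends
-- (number of bends = number of corners - 2).
record B2Path : Set where
  field
    corners  : List Point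
    chain    : Chain nothing corners
    atLeast1 : 2 ℕ.≤ length corners
    atMost2B : length corners ℕ.≤ 4
open B2Path public

-- Windows: each segment (p , q) together with the corner before p and the
-- corner after q (nothing if the path stops there).
Window : Set
Window = Maybe Point × Point × Point × Maybe Point

head? : List Point → Maybe Point
head? []      = nothing
head? (x ∷ _) = just x

windows' : Maybe Point → List Point → List Window
windows' prev (p ∷ q ∷ rest) = (prev , p , q , head? rest) ∷ windows' (just p) (q ∷ rest)
windows' prev _ = []

segments : B2Path → List Window
segments P = windows' nothing (corners P)

-- Grid edge [e , e+1] of a row lies within [α , β].
EdgeIn : ℤ → ℤ → ℤ → Set
EdgeIn e α β = α ≤ e × e + + 1 ≤ β

SegHas : Point → Point → GridEdge → Set
SegHas (x₁ , y₁) (x₂ , y₂) (hE x y) =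
  y₁ ≡ y × y₂ ≡ y × EdgeIn x (x₁ ⊓ x₂) (x₁ ⊔ x₂)
SegHas (x₁ , y₁) (x₂ , y₂) (vE x y) =
  x₁ ≡ x × x₂ ≡ x × EdgeIn y (y₁ ⊓ y₂) (y₁ ⊔ y₂)

HasEdge : B2Path → GridEdge → Set
HasEdge P g = ∃[ w ] (w ∈ segments P × SegHas (proj₁ (proj₂ w)) (proj₁ (proj₂ (proj₂ w))) g)

ShareEdge : B2Path → B2Path → Set
ShareEdge P Q = ∃[ g ] (HasEdge P g × HasEdge Q g)

IsB2EPGRep : {V : Set} → (V → V → Set) → (V → B2Path) → Set
IsB2EPGRep {V} Adj P = ∀ (u v : V) → u ≢ v →
  (Adj u v → ShareEdge (P u) (P v)) × (ShareEdge (P u) (P v) → Adj u v)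

InIndex : B2Path → ℤ → Set
InIndex P a = ∃[ x ] HasEdge P (hE x a)

data Ty : Set where
  none down up : Ty

record TInterval : Set where
  constructor mkTI
  field
    lt  : Ty
    α   : ℤ
    rt  : Ty
    β   : ℤ
    α≤β : α ≤ β
open TInterval public

Proper : TInterval → Set
Proper t = α t ≢ β t ⊎ (α t ≡ β t × lt t ≡ rt t × lt t ≢ none)

IsEndOf : Ty → ℤ → TInterval → Set
IsEndOf z γ t = (z ≡ lt t × γ ≡ α t) ⊎ (z ≡ rt t × γ ≡ β t)

-- t is coherent with the left endpoint x'α' of t'
-- (the grid edge of [α',β'] incident to α' is [α', α'+1])
CohL : TInterval → TInterval → Set
CohL t t' =
    (α t < α t' × α t' < β t)
  ⊎ (lt t' ≡ none × α t' < β t' × EdgeIn (α t') (α t) (β t))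
  ⊎ (lt t' ≢ none × IsEndOf (lt t') (α t') t)

-- t is coherent with the right endpoint y'β' of t'
-- (the grid edge of [α',β'] incident to β' is [β'-1, β'])
CohR : TInterval → TInterval → Set
CohR t t' =
    (α t < β t' × β t' < β t)
  ⊎ (rt t' ≡ none × α t' < β t' × EdgeIn (β t' - + 1) (α t) (β t))
  ⊎ (rt t' ≢ none × IsEndOf (rt t') (β t') t)

ContainsTI : TInterval → TInterval → Set
ContainsTI t t' = (α t ≤ α t' × β t' ≤ β t) × CohL t t' × CohR t t'

IntersectsTI : TInterval → TInterval → Set
IntersectsTI t t' =
    (∃[ e ] (EdgeIn e (α t) (β t) × EdgeIn e (α t') (β t')))
  ⊎ CohL t t' ⊎ CohR t t' ⊎ CohL t' t ⊎ CohR t' t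

-- Type of an extremity on row a, given the corner adjacent to it along the
-- path (nothing: the path stops there).
data TypeAt (a : ℤ) : Maybe Point → Ty → Set where
  stopT : TypeAt a nothing none
  downT : ∀ {x y} → y < a → TypeAt a (just (x , y)) down
  upT   : ∀ {x y} → a < y → TypeAt a (just (x , y)) up

data WinProj (a : ℤ) : Window → TInterval → Set where
  fwd : ∀ {pr nx α β x y} (le : α ≤ β) → α < β →
        TypeAt a pr x → TypeAt a nx y →
        WinProj a (pr , (α , a) , (β , a) , nx) (mkTI x α y β le)
  bwd : ∀ {pr nx α β x y} (le : α ≤ β) → α < β →
        TypeAt a nx x → TypeAt a pr y →
        WinProj a (pr , (β , a) , (α , a) , nx) (mkTI x α y β le)

TProj : B2Path → ℤ → TInterval → Set
TProj P a t = ∃[ w ] (w ∈ segments P × WinProj a w t)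

ContainsOn : B2Path → ℤ → TInterval → Set
ContainsOn P a t = InIndex P a × ∃[ t' ] (TProj P a t' × ContainsTI t' t)

IntersectsOn : B2Path → ℤ → TInterval → Set
IntersectsOn P a t = InIndex P a × ∃[ t' ] (TProj P a t' × IntersectsTI t' t)

-- The t-projections s, s' of u and v on row a overlap: they share a grid edge
-- of the row, or a common endpoint at which both paths bend in the same
-- direction.  Indeed, v meets t either along an edge (which lies in s ⊇ t) or
-- through a typed point — an endpoint of t or of s' — with which s and s' are
-- both coherent (s because it contains t), and two intervals coherent with
-- the same typed point overlap.  A shared bend at γ towards z makes both paths
-- use the vertical grid edge leaving γ towards z, so in either case P u and
-- P v share a grid edge.

module Submission where

open import Defs
open import Data.Integer using (ℤ; _+_; _-_; _≤_; _<_; +_; -_)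
open import Data.Integer.Properties
open import Data.Maybe using (just; nothing)
open import Data.List.Membership.Propositional using (_∈_)
open import Data.List.Relation.Unary.Any using (here; there)
open import Data.Product using (_×_; _,_; proj₂; ∃-syntax)
open import Data.Sum using (_⊎_; inj₁; inj₂)
open import Data.Empty using (⊥-elim)
open import Relation.Binary.PropositionalEquality
  using (_≡_; _≢_; refl; sym; trans; cong; subst; subst₂)

i<j⇒i+1≤j : ∀ {i j} → i < j → i + + 1 ≤ j
i<j⇒i+1≤j {i} i<j = subst (_≤ _) (+-comm (+ 1) i) (i<j⇒suc[i]≤j i<j)

i-1+1≡i : ∀ i → i - + 1 + + 1 ≡ i
i-1+1≡i i = trans (+-assoc i (- + 1) (+ 1))
  (trans (cong (λ k → i + k) (+-inverseˡ (+ 1))) (+-identityʳ i))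

i+1-1≡i : ∀ i → i + + 1 - + 1 ≡ i
i+1-1≡i i = trans (+-assoc i (+ 1) (- + 1))
  (trans (cong (λ k → i + k) (+-inverseʳ (+ 1))) (+-identityʳ i))

i<j⇒i≤j-1 : ∀ {i j} → i < j → i ≤ j - + 1
i<j⇒i≤j-1 {i} {j} i<j = subst (_≤ j - + 1) (i+1-1≡i i) (+-monoˡ-≤ (- + 1) (i<j⇒i+1≤j i<j))

data Overlap (s s' : TInterval) : Set where
  sharedEdge : ∀ e → EdgeIn e (α s) (β s) → EdgeIn e (α s') (β s') → Overlap s s'
  sharedBend : ∀ {z γ} → z ≢ none → IsEndOf z γ s → IsEndOf z γ s' → Overlap s s'

overlap-sym : ∀ {s s'} → Overlap s s' → Overlap s' s
overlap-sym (sharedEdge e e∈s e∈s')    = sharedEdge e e∈s' e∈s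
overlap-sym (sharedBend z≢∅ end end') = sharedBend z≢∅ end' end

data Incident (γ : ℤ) : ℤ → Set where
  rightEdge : Incident γ γ
  leftEdge  : Incident γ (γ - + 1)

-- Coherence with the typed point zγ whose incident edge is e:  CohL s t is
-- the case zγ = (lt t) (α t), e = α t, and CohR s t the case zγ = (rt t) (β t),
-- e = β t - 1.
data Coherent (s : TInterval) (z : Ty) (γ e : ℤ) : Set where
  interior : α s < γ → γ < β s → Coherent s z γ e
  emptyEnd : z ≡ none → EdgeIn e (α s) (β s) → Coherent s z γ e
  bendEnd  : z ≢ none → IsEndOf z γ s → Coherent s z γ e

cohL⇒coherent : ∀ s t → CohL s t → Coherent s (lt t) (α t) (α t)
cohL⇒coherent _ _ (inj₁ (α<γ , γ<β))            = interior α<γ γ<β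
cohL⇒coherent _ _ (inj₂ (inj₁ (z≡∅ , _ , e∈s))) = emptyEnd z≡∅ e∈s
cohL⇒coherent _ _ (inj₂ (inj₂ (z≢∅ , end)))     = bendEnd z≢∅ end

cohR⇒coherent : ∀ s t → CohR s t → Coherent s (rt t) (β t) (β t - + 1)
cohR⇒coherent _ _ (inj₁ (α<γ , γ<β))            = interior α<γ γ<β
cohR⇒coherent _ _ (inj₂ (inj₁ (z≡∅ , _ , e∈s))) = emptyEnd z≡∅ e∈s
cohR⇒coherent _ _ (inj₂ (inj₂ (z≢∅ , end)))     = bendEnd z≢∅ end

coherent-leftEnd : ∀ s → α s < β s → Coherent s (lt s) (α s) (α s)
coherent-leftEnd (mkTI none _ _ _ _) α<β = emptyEnd refl (≤-refl , i<j⇒i+1≤j α<β)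
coherent-leftEnd (mkTI down _ _ _ _) _   = bendEnd (λ ()) (inj₁ (refl , refl))
coherent-leftEnd (mkTI up _ _ _ _)   _   = bendEnd (λ ()) (inj₁ (refl , refl))

coherent-rightEnd : ∀ s → α s < β s → Coherent s (rt s) (β s) (β s - + 1)
coherent-rightEnd (mkTI _ _ none β _) α<β = emptyEnd refl (i<j⇒i≤j-1 α<β , ≤-reflexive (i-1+1≡i β))
coherent-rightEnd (mkTI _ _ down _ _) _   = bendEnd (λ ()) (inj₂ (refl , refl))
coherent-rightEnd (mkTI _ _ up _ _)   _   = bendEnd (λ ()) (inj₂ (refl , refl))

coherent-bend : ∀ {s z γ e} e' → z ≢ none → Coherent s z γ e → Coherent s z γ e'
coherent-bend _ _   (interior α<γ γ<β) = interior α<γ γ<β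
coherent-bend _ z≢∅ (emptyEnd z≡∅ _)   = ⊥-elim (z≢∅ z≡∅)
coherent-bend _ _   (bendEnd z≢∅ end)  = bendEnd z≢∅ end

edgeIn-mono : ∀ {e a b a' b'} → a' ≤ a → b ≤ b' → EdgeIn e a b → EdgeIn e a' b'
edgeIn-mono a'≤a b≤b' (a≤e , e+1≤b) = ≤-trans a'≤a a≤e , ≤-trans e+1≤b b≤b'

contains⇒coherent : ∀ {s t z γ e} → ContainsTI s t → Coherent t z γ e → Coherent s z γ e
contains⇒coherent ((αs≤αt , βt≤βs) , _) (interior αt<γ γ<βt) =
  interior (≤-<-trans αs≤αt αt<γ) (<-≤-trans γ<βt βt≤βs)
contains⇒coherent ((αs≤αt , βt≤βs) , _) (emptyEnd z≡∅ e∈t) =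
  emptyEnd z≡∅ (edgeIn-mono αs≤αt βt≤βs e∈t)
contains⇒coherent {s} {t} {e = e} (_ , cohL , _) (bendEnd z≢∅ (inj₁ (refl , refl))) =
  coherent-bend e z≢∅ (cohL⇒coherent s t cohL)
contains⇒coherent {s} {t} {e = e} (_ , _ , cohR) (bendEnd z≢∅ (inj₂ (refl , refl))) =
  coherent-bend e z≢∅ (cohR⇒coherent s t cohR)

interior⇒edgeIn : ∀ {γ e} s → Incident γ e → α s < γ → γ < β s → EdgeIn e (α s) (β s)
interior⇒edgeIn s rightEdge α<γ γ<β = <⇒≤ α<γ , i<j⇒i+1≤j γ<β
interior⇒edgeIn {γ} s leftEdge α<γ γ<β =
  i<j⇒i≤j-1 α<γ , subst (_≤ β s) (sym (i-1+1≡i γ)) (<⇒≤ γ<β)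

end⇒edgeIn : ∀ {z γ} s → α s < β s → IsEndOf z γ s →
  ∃[ e ] (Incident γ e × EdgeIn e (α s) (β s))
end⇒edgeIn s α<β (inj₁ (_ , refl)) = α s , rightEdge , ≤-refl , i<j⇒i+1≤j α<β
end⇒edgeIn s α<β (inj₂ (_ , refl)) =
  β s - + 1 , leftEdge , i<j⇒i≤j-1 α<β , ≤-reflexive (i-1+1≡i (β s))

interior-coherent⇒overlap : ∀ {s s' z γ e} → Incident γ e → α s' < β s' →
  α s < γ → γ < β s → Coherent s' z γ e → Overlap s s'
interior-coherent⇒overlap {s} {s'} inc _ α<γ γ<β (interior α'<γ γ<β') =
  sharedEdge _ (interior⇒edgeIn s inc α<γ γ<β) (interior⇒edgeIn s' inc α'<γ γ<β')
interior-coherent⇒overlap {s} inc _ α<γ γ<β (emptyEnd _ e∈s') =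
  sharedEdge _ (interior⇒edgeIn s inc α<γ γ<β) e∈s'
interior-coherent⇒overlap {s} {s'} _ α'<β' α<γ γ<β (bendEnd _ end)
  with end⇒edgeIn s' α'<β' end
... | e , inc , e∈s' = sharedEdge e (interior⇒edgeIn s inc α<γ γ<β) e∈s'

coherent-coherent⇒overlap : ∀ {s s' z γ e} → Incident γ e → α s < β s → α s' < β s' →
  Coherent s z γ e → Coherent s' z γ e → Overlap s s'
coherent-coherent⇒overlap inc _ α'<β' (interior α<γ γ<β) coh' =
  interior-coherent⇒overlap inc α'<β' α<γ γ<β coh'
coherent-coherent⇒overlap inc α<β _ coh (interior α'<γ γ<β') =
  overlap-sym (interior-coherent⇒overlap inc α<β α'<γ γ<β' coh)
coherent-coherent⇒overlap _ _ _ (emptyEnd _ e∈s) (emptyEnd _ e∈s') = sharedEdge _ e∈s e∈s'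
coherent-coherent⇒overlap _ _ _ (emptyEnd z≡∅ _) (bendEnd z≢∅ _)   = ⊥-elim (z≢∅ z≡∅)
coherent-coherent⇒overlap _ _ _ (bendEnd z≢∅ _) (emptyEnd z≡∅ _)   = ⊥-elim (z≢∅ z≡∅)
coherent-coherent⇒overlap _ _ _ (bendEnd z≢∅ end) (bendEnd _ end') =
  sharedBend z≢∅ end end'

contains∧intersects⇒overlap : ∀ {s s' t} → α s < β s → α s' < β s' →
  ContainsTI s t → IntersectsTI s' t → Overlap s s'
contains∧intersects⇒overlap _ _ ((αs≤αt , βt≤βs) , _) (inj₁ (e , e∈s' , e∈t)) =
  sharedEdge e (edgeIn-mono αs≤αt βt≤βs e∈t) e∈s'
contains∧intersects⇒overlap {s} {s'} {t} l l' (_ , cohL , _) (inj₂ (inj₁ cohL')) =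
  coherent-coherent⇒overlap rightEdge l l' (cohL⇒coherent s t cohL) (cohL⇒coherent s' t cohL')
contains∧intersects⇒overlap {s} {s'} {t} l l' (_ , _ , cohR) (inj₂ (inj₂ (inj₁ cohR'))) =
  coherent-coherent⇒overlap leftEdge l l' (cohR⇒coherent s t cohR) (cohR⇒coherent s' t cohR')
contains∧intersects⇒overlap {s' = s'} {t} l l' s⊇t (inj₂ (inj₂ (inj₂ (inj₁ cohL)))) =
  coherent-coherent⇒overlap rightEdge l l'
    (contains⇒coherent s⊇t (cohL⇒coherent t s' cohL)) (coherent-leftEnd s' l')
contains∧intersects⇒overlap {s' = s'} {t} l l' s⊇t (inj₂ (inj₂ (inj₂ (inj₂ cohR)))) =
  coherent-coherent⇒overlap leftEdge l l'
    (contains⇒coherent s⊇t (cohR⇒coherent t s' cohR)) (coherent-rightEnd s' l')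

window-step : ∀ {o L prev pr p q nx} → Chain o L → (pr , p , q , nx) ∈ windows' prev L →
  ∃[ o' ] Step p q o'
window-step (step s _ _)  (here refl) = _ , s
window-step (step _ _ ch) (there w)   = window-step ch w

window-next : ∀ {o L prev pr p q c} → Chain o L → (pr , p , q , just c) ∈ windows' prev L →
  ∃[ pr' ] ∃[ nx' ] ((pr' , q , c , nx') ∈ windows' prev L)
window-next (step _ _ (step _ _ _)) (here refl) = _ , _ , there (here refl)
window-next (step _ _ ch) (there w) with window-next ch w
... | pr' , nx' , w' = pr' , nx' , there w'

window-prev : ∀ {o L prev c p q nx} → Chain o L → (just c , p , q , nx) ∈ windows' prev L →
  (prev ≡ just c × head? L ≡ just p) ⊎ ∃[ pr' ] ∃[ nx' ] ((pr' , c , p , nx') ∈ windows' prev L)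
window-prev (step _ _ _)  (here refl) = inj₁ (refl , refl)
window-prev (step _ _ ch) (there w) with window-prev ch w
... | inj₁ (refl , refl)     = inj₂ (_ , _ , here refl)
... | inj₂ (pr' , nx' , w') = inj₂ (pr' , nx' , there w')

segment-prev : ∀ P {c p q nx} → (just c , p , q , nx) ∈ segments P →
  ∃[ pr' ] ∃[ nx' ] ((pr' , c , p , nx') ∈ segments P)
segment-prev P w with window-prev (chain P) w
... | inj₁ (() , _)
... | inj₂ w' = w'

-- The vertical grid edge leaving point γ of row a in direction z
-- (meaningless for z = none).
verticalEdge : ℤ → Ty → ℤ → GridEdge
verticalEdge a down γ = vE γ (a - + 1)
verticalEdge a up   γ = vE γ a
verticalEdge a none γ = vE γ a

step-sym : ∀ {p q o} → Step p q o → Step q p o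
step-sym (hstep x≢x') = hstep (λ x'≡x → x≢x' (sym x'≡x))
step-sym (vstep y≢y') = vstep (λ y'≡y → y≢y' (sym y'≡y))

segHas-sym : ∀ p q g → SegHas p q g → SegHas q p g
segHas-sym (x₁ , _) (x₂ , _) (hE x _) (y₁≡y , y₂≡y , e∈) =
  y₂≡y , y₁≡y , subst₂ (EdgeIn x) (⊓-comm x₁ x₂) (⊔-comm x₁ x₂) e∈
segHas-sym (_ , y₁) (_ , y₂) (vE _ y) (x₁≡x , x₂≡x , e∈) =
  x₂≡x , x₁≡x , subst₂ (EdgeIn y) (⊓-comm y₁ y₂) (⊔-comm y₁ y₂) e∈

segment-verticalEdge : ∀ {a c γ o z} → Step c (γ , a) o → TypeAt a (just c) z →
  SegHas c (γ , a) (verticalEdge a z γ)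
segment-verticalEdge (hstep _) (downT y<a) = ⊥-elim (<-irrefl refl y<a)
segment-verticalEdge (hstep _) (upT a<y)   = ⊥-elim (<-irrefl refl a<y)
segment-verticalEdge {a} (vstep _) (downT y<a)
  rewrite i≤j⇒i⊓j≡i (<⇒≤ y<a) | i≤j⇒i⊔j≡j (<⇒≤ y<a) | i-1+1≡i a =
  refl , refl , i<j⇒i≤j-1 y<a , ≤-refl
segment-verticalEdge (vstep _) (upT a<y)
  rewrite i≥j⇒i⊓j≡j (<⇒≤ a<y) | i≥j⇒i⊔j≡i (<⇒≤ a<y) =
  refl , refl , ≤-refl , i<j⇒i+1≤j a<y

bendBefore-edge : ∀ P a {pr γ q nx z} → (pr , (γ , a) , q , nx) ∈ segments P →
  TypeAt a pr z → z ≢ none → HasEdge P (verticalEdge a z γ)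
bendBefore-edge P a {nothing} _ stopT z≢∅ = ⊥-elim (z≢∅ refl)
bendBefore-edge P a {just c} w ty _ with segment-prev P w
... | _ , _ , w' = _ , w' , segment-verticalEdge (proj₂ (window-step (chain P) w')) ty

bendAfter-edge : ∀ P a {pr p γ nx z} → (pr , p , (γ , a) , nx) ∈ segments P →
  TypeAt a nx z → z ≢ none → HasEdge P (verticalEdge a z γ)
bendAfter-edge P a {nx = nothing} _ stopT z≢∅ = ⊥-elim (z≢∅ refl)
bendAfter-edge P a {γ = γ} {just c} w ty _ with window-next (chain P) w
... | _ , _ , w' = _ , w' , segHas-sym c (γ , a) _
  (segment-verticalEdge (step-sym (proj₂ (window-step (chain P) w'))) ty)

tProj-strict : ∀ P {a s} → TProj P a s → α s < β s
tProj-strict _ (_ , _ , fwd _ α<β _ _) = α<β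
tProj-strict _ (_ , _ , bwd _ α<β _ _) = α<β

tProj-edge : ∀ P {a s e} → TProj P a s → EdgeIn e (α s) (β s) → HasEdge P (hE e a)
tProj-edge _ {e = e} (w , w∈ , fwd α≤β _ _ _) e∈s =
  w , w∈ , refl , refl , subst₂ (EdgeIn e) (sym (i≤j⇒i⊓j≡i α≤β)) (sym (i≤j⇒i⊔j≡j α≤β)) e∈s
tProj-edge _ {e = e} (w , w∈ , bwd α≤β _ _ _) e∈s =
  w , w∈ , refl , refl , subst₂ (EdgeIn e) (sym (i≥j⇒i⊓j≡j α≤β)) (sym (i≥j⇒i⊔j≡i α≤β)) e∈s

tProj-bend : ∀ P {a s z γ} → TProj P a s → z ≢ none → IsEndOf z γ s →
  HasEdge P (verticalEdge a z γ)
tProj-bend P {a} (_ , w , fwd _ _ tyα _) z≢∅ (inj₁ (refl , refl)) = bendBefore-edge P a w tyα z≢∅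
tProj-bend P {a} (_ , w , fwd _ _ _ tyβ) z≢∅ (inj₂ (refl , refl)) = bendAfter-edge P a w tyβ z≢∅
tProj-bend P {a} (_ , w , bwd _ _ tyα _) z≢∅ (inj₁ (refl , refl)) = bendAfter-edge P a w tyα z≢∅
tProj-bend P {a} (_ , w , bwd _ _ _ tyβ) z≢∅ (inj₂ (refl , refl)) = bendBefore-edge P a w tyβ z≢∅

overlap⇒shareEdge : ∀ P Q {a s s'} → TProj P a s → TProj Q a s' → Overlap s s' → ShareEdge P Q
overlap⇒shareEdge P Q {a} πP πQ (sharedEdge e e∈s e∈s') =
  hE e a , tProj-edge P πP e∈s , tProj-edge Q πQ e∈s'
overlap⇒shareEdge P Q {a} πP πQ (sharedBend {z} {γ} z≢∅ end end') =
  verticalEdge a z γ , tProj-bend P πP z≢∅ end , tProj-bend Q πQ z≢∅ end'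

mainTheorem3 : {V : Set} (Adj : V → V → Set) (P : V → B2Path) →
    IsB2EPGRep Adj P →
    (a : ℤ) (u v : V) → u ≢ v →
    InIndex (P u) a → InIndex (P v) a →
    (t : TInterval) → Proper t →
    ContainsOn (P u) a t → IntersectsOn (P v) a t →
    Adj u v
mainTheorem3 Adj P rep a u v u≢v _ _ t _ (_ , s , πu , s⊇t) (_ , s' , πv , s'∩t) =
  proj₂ (rep u v u≢v)
    (overlap⇒shareEdge (P u) (P v) πu πv
      (contains∧intersects⇒overlap {t = t}
        (tProj-strict (P u) πu) (tProj-strict (P v) πv) s⊇t s'∩t))
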